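{- Let $G=(V,E)$ be a connected graph, let $r\colon V\to\mathbb{N}$, let $\mathcal{T}$ be a tree-decomposition of $G$, let $B$ be a bag of $\mathcal{T}$, and let $T_B$ be an $r$-covering subtree of $\mathcal{T}$ containing $B$ with the minimum number of bags among all $r$-covering subtrees containing $B$. Then for each leaf $B'\ne B$ of $T_B$ there is a minimum $r$-covering subtree of $\mathcal{T}$ that contains $B'$.
   Context: All graphs are finite, connected, unweighted, undirected and simple; $d_G$ is the shortest-path distance and $d_G(v,S)=\min_{u\in S}d_G(v,u)$. A tree-decomposition of $G$ is a tree whose nodes (bags) are subsets of $V$ such that every vertex lies in some bag, every edge has both ends in some bag, and the bags containing any fixed vertex induce a subtree. A subtree $T'$ of $\mathcal{T}$ is $r$-covering if for every vertex $v$ of $G$ there is a bag $B'$ of $T'$ with $d_G(v,B')\le r(v)$. A minimum $r$-covering subtree is one with the fewest bags among all $r$-covering subtrees of $\mathcal{T}$. -}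

module Defs where

open import Data.Nat using (ℕ; zero; suc; _≤_)
open import Data.Bool using (Bool; true; false; T)
open import Data.Fin using (Fin)
open import Data.Fin.Subset using (Subset; _∈_; _∩_; ∣_∣)
open import Data.Vec using (tabulate; lookup)
open import Data.List using (List; []; _∷_)
open import Data.List.Relation.Unary.All using (All)
open import Data.List.Relation.Unary.Unique.Propositional using (Unique)
open import Data.Product using (Σ; ∃; ∃-syntax; _×_; _,_)
open import Relation.Binary.PropositionalEquality using (_≡_; _≢_)
open import Relation.Nullary using (¬_)

record Graph (n : ℕ) : Set where
  field
    adj     : Fin n → Fin n → Bool
    symm    : ∀ u v → T (adj u v) → T (adj v u)
    irrefl  : ∀ v → ¬ T (adj v v)

module _ {n : ℕ} (G : Graph n) where
  open Graph G

  data Walk : Fin n → Fin n → Set where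
    here : ∀ v → Walk v v
    step : ∀ {u v w} → T (adj u v) → Walk v w → Walk u w

  walkLength : ∀ {u v} → Walk u v → ℕ
  walkLength (here _)   = zero
  walkLength (step _ w) = suc (walkLength w)

  vertices : ∀ {u v} → Walk u v → List (Fin n)
  vertices (here v)          = v ∷ []
  vertices (step {u} _ w)    = u ∷ vertices w

  IsPath : ∀ {u v} → Walk u v → Set
  IsPath w = Unique (vertices w)

  Connected : Set
  Connected = ∀ u v → Walk u v

  DistLe : Fin n → Fin n → ℕ → Set
  DistLe u v k = Σ (Walk u v) λ w → walkLength w ≤ k

  DistSetLe : Fin n → Subset n → ℕ → Set
  DistSetLe v S k = ∃[ u ] (u ∈ S × DistLe v u k)

  IsTree : Set
  IsTree = Connected ×
           (∀ u v (p q : Walk u v) → IsPath p → IsPath q → vertices p ≡ vertices q)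

  InducesConnected : Subset n → Set
  InducesConnected S = ∀ u v → u ∈ S → v ∈ S →
                       Σ (Walk u v) λ w → All (_∈ S) (vertices w)

  N : Fin n → Subset n
  N v = tabulate (adj v)

  degIn : Subset n → Fin n → ℕ
  degIn S v = ∣ S ∩ N v ∣

record TreeDecomposition {n : ℕ} (G : Graph n) : Set where
  field
    m      : ℕ
    tree   : Graph m
    isTree : IsTree tree
    bag    : Fin m → Subset n
    vertexCovered : ∀ v → ∃[ t ] (v ∈ bag t)
    edgeCovered   : ∀ u v → T (Graph.adj G u v) → ∃[ t ] (u ∈ bag t × v ∈ bag t)
    coherent      : ∀ v → InducesConnected tree (tabulate λ t → lookup (bag t) v)

module _ {n : ℕ} {G : Graph n} (𝒯 : TreeDecomposition G) where
  open TreeDecomposition 𝒯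

  IsSubtree : Subset m → Set
  IsSubtree S = (∃[ t ] (t ∈ S)) × InducesConnected tree S

  RCovering : (Fin n → ℕ) → Subset m → Set
  RCovering r S = ∀ v → ∃[ t ] (t ∈ S × DistSetLe G v (bag t) (r v))

  MinRCovering : (Fin n → ℕ) → Subset m → Set
  MinRCovering r S = IsSubtree S × RCovering r S ×
    (∀ S′ → IsSubtree S′ → RCovering r S′ → ∣ S ∣ ≤ ∣ S′ ∣)

  MinRCoveringContaining : (Fin n → ℕ) → Fin m → Subset m → Set
  MinRCoveringContaining r B S = IsSubtree S × B ∈ S × RCovering r S ×
    (∀ S′ → IsSubtree S′ → B ∈ S′ → RCovering r S′ → ∣ S ∣ ≤ ∣ S′ ∣)

  LeafOf : Subset m → Fin m → Set
  LeafOf S B′ = B′ ∈ S × degIn tree S B′ ≡ 1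

module Submission where

-- Let T_B be a minimum r-covering subtree among those containing the bag B,
-- let B′ ≠ B be a leaf of T_B and P its unique neighbour in T_B.  Removing the
-- leaf leaves a subtree U = T_B - B′ that still contains B but has fewer bags,
-- so U is not r-covering: some vertex v is covered by B′ and by no bag of U.
-- Now take any minimum r-covering subtree S.  If B′ ∈ S we are done.
-- Otherwise we show that the single bag B′ already covers every vertex w, so
-- that ⁅ B′ ⁆ is a minimum r-covering subtree.  The tool is a separation
-- property of tree-decompositions: if a walk of length ℓ in G runs from a
-- vertex of bag X to a vertex of bag Y, then either the bag Z contains a vertex
-- within distance ℓ of the start, or X and Y are joined in the tree by a walk
-- avoiding Z.  Applied to v it joins the bag X ∈ S covering v to B′ avoiding P;
-- applied to a vertex w not covered by B′ it joins X to P avoiding B′.  Both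
-- together contradict uniqueness of paths in a tree across the edge B′P.

open import Defs
open import Data.Nat using (ℕ; zero; suc; _≤_; _<_; z≤n; s≤s)
open import Data.Nat.Properties using (≤-trans; ≤-refl; ≤-pred; n≤1+n; <⇒≱; ≮⇒≥; n≮0; _<?_; suc-injective)
open import Data.Bool using (Bool; T)
open import Data.Bool.Properties using (T-≡)
open import Data.Fin using (Fin) renaming (zero to fzero; suc to fsuc; _≟_ to _≟ᶠ_)
open import Data.Fin.Properties using (any?; all?; ¬∀⟶∃¬)
open import Data.Fin.Subset using (Subset; _∈_; _∉_; ⁅_⁆; _-_; _─_; _∩_; ∣_∣; ⊤; inside; outside)
open import Data.Fin.Subset.Properties
  using (_∈?_; ∈⊤; ∣⊤∣≡n; ∣⁅x⁆∣≡1; x∈⁅x⁆; x∈⁅y⁆⇒x≡y; x∈p∩q⁺; x∈p∩q⁻; x∈p∧x≢y⇒x∈p-y; x∈p⇒∣p-x∣<∣p∣; x∉⁅y⁆⇒x≢y; p─q⊆p; anySubset?)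
open import Data.Vec using (_∷_; tabulate; lookup; here; there)
open import Data.Vec.Properties using (lookup∘tabulate; []=⇒lookup; lookup⇒[]=)
open import Data.List using (List; []; _∷_; length)
open import Data.List.Relation.Unary.All as All using (All; []; _∷_)
open import Data.List.Relation.Unary.All.Properties using (anti-mono; ¬Any⇒All¬)
open import Data.List.Relation.Unary.Any using (here; there)
open import Data.List.Relation.Unary.Unique.Propositional using (Unique; []; _∷_)
open import Data.List.Membership.Propositional using () renaming (_∈_ to _∈ₗ_)
open import Data.List.Relation.Binary.Subset.Propositional using () renaming (_⊆_ to _⊆ₗ_)
open import Data.Product using (Σ; ∃-syntax; _×_; _,_; proj₁; proj₂)
open import Data.Sum using (_⊎_; inj₁; inj₂)
open import Data.Empty using (⊥; ⊥-elim)
open import Data.Unit using (tt) renaming (⊤ to Unit)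
open import Function using (_∘_; id; _⇔_; mk⇔; Equivalence)
open import Relation.Binary.PropositionalEquality using (_≡_; _≢_; refl; sym; trans; cong; subst)
open import Relation.Nullary using (¬_; Dec; yes; no)
open import Relation.Nullary.Decidable using (map′; T?; _×-dec_; _⊎-dec_; _→-dec_)
open import Relation.Unary using (Decidable)

∈⇔T-lookup : ∀ {k} {p : Subset k} {x} → x ∈ p ⇔ T (lookup p x)
∈⇔T-lookup {p = p} {x} = mk⇔ (Equivalence.from T-≡ ∘ []=⇒lookup) (lookup⇒[]= x p ∘ Equivalence.to T-≡)

∈-tabulate : ∀ {k} (f : Fin k → Bool) {x} → x ∈ tabulate f ⇔ T (f x)
∈-tabulate f {x} = mk⇔ (subst T (lookup∘tabulate f x) ∘ Equivalence.to ∈⇔T-lookup)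
                        (Equivalence.from ∈⇔T-lookup ∘ subst T (sym (lookup∘tabulate f x)))

∣p∣≡0⇒∉ : ∀ {k} (p : Subset k) → ∣ p ∣ ≡ 0 → ∀ {y} → y ∉ p
∣p∣≡0⇒∉ (outside ∷ p) eq (there y∈p) = ∣p∣≡0⇒∉ p eq y∈p

∣p∣≡1⇒singleton : ∀ {k} (p : Subset k) → ∣ p ∣ ≡ 1 →
                  ∃[ x ] (x ∈ p × ∀ {y} → y ∈ p → y ≡ x)
∣p∣≡1⇒singleton (inside ∷ p) eq = fzero , here , λ
  { here → refl
  ; (there y∈p) → ⊥-elim (∣p∣≡0⇒∉ p (suc-injective eq) y∈p) }
∣p∣≡1⇒singleton (outside ∷ p) eq with ∣p∣≡1⇒singleton p eq
... | x , x∈p , unique = fsuc x , there x∈p , λ { (there y∈p) → cong fsuc (unique y∈p) }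

x∈p─q⇒x∉q : ∀ {k} (p q : Subset k) {x} → x ∈ p ─ q → x ∉ q
x∈p─q⇒x∉q (_ ∷ p) (outside ∷ q) here ()
x∈p─q⇒x∉q (_ ∷ p) (_ ∷ q) (there x∈p─q) (there x∈q) = x∈p─q⇒x∉q p q x∈p─q x∈q

unique-length : ∀ {k} {xs : List (Fin k)} {S : Subset k} → Unique xs → All (_∈ S) xs → length xs ≤ ∣ S ∣
unique-length [] [] = z≤n
unique-length {xs = x ∷ _} {S} (x∉xs ∷ xs-unique) (x∈S ∷ xs⊆S) =
  ≤-trans (s≤s (unique-length xs-unique (All.zipWith into-S-x (xs⊆S , x∉xs)))) (x∈p⇒∣p-x∣<∣p∣ x∈S)
  where
  into-S-x : ∀ {y} → y ∈ S × x ≢ y → y ∈ S - x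
  into-S-x (y∈S , x≢y) = x∈p∧x≢y⇒x∈p-y y∈S (x≢y ∘ sym)

∈⇒1≤∣p∣ : ∀ {k} {p : Subset k} {x} → x ∈ p → 1 ≤ ∣ p ∣
∈⇒1≤∣p∣ x∈p = ≤-trans (s≤s z≤n) (x∈p⇒∣p-x∣<∣p∣ x∈p)

minimum-witness : ∀ {k} {Q : Subset k → Set} → Decidable Q → ∀ S → Q S →
                  ∃[ S* ] (Q S* × ∀ S′ → Q S′ → ∣ S* ∣ ≤ ∣ S′ ∣)
minimum-witness {Q = Q} Q? S q = search ∣ S ∣ S q ≤-refl
  where
  search : ∀ fuel S → Q S → ∣ S ∣ ≤ fuel → ∃[ S* ] (Q S* × ∀ S′ → Q S′ → ∣ S* ∣ ≤ ∣ S′ ∣)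
  search fuel S q bound with anySubset? (λ S′ → Q? S′ ×-dec (∣ S′ ∣ <? ∣ S ∣))
  ... | no none-smaller = S , q , λ S′ q′ → ≮⇒≥ (λ lt → none-smaller (S′ , q′ , lt))
  search zero S q bound | yes (S′ , q′ , lt) = ⊥-elim (n≮0 (≤-trans lt bound))
  search (suc fuel) S q bound | yes (S′ , q′ , lt) = search fuel S′ q′ (≤-pred (≤-trans lt bound))

module Walks {k : ℕ} (H : Graph k) where
  open Graph H
  open import Data.List.Membership.DecPropositional (_≟ᶠ_ {k}) using () renaming (_∈?_ to _∈ₗ?_)

  WalkIn : (Fin k → Set) → Fin k → Fin k → Set
  WalkIn P x y = Σ (Walk H x y) λ w → All P (vertices H w)

  start∈ : ∀ {x y} (w : Walk H x y) → x ∈ₗ vertices H w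
  start∈ (here _)   = here refl
  start∈ (step _ _) = here refl

  infixr 5 _++ʷ_
  _++ʷ_ : ∀ {x y z} → Walk H x y → Walk H y z → Walk H x z
  here _   ++ʷ w′ = w′
  step e w ++ʷ w′ = step e (w ++ʷ w′)

  all-++ʷ : ∀ {P : Fin k → Set} {x y z} (w : Walk H x y) (w′ : Walk H y z) →
            All P (vertices H w) → All P (vertices H w′) → All P (vertices H (w ++ʷ w′))
  all-++ʷ (here _)   w′ _        A′ = A′
  all-++ʷ (step e w) w′ (a ∷ A) A′ = a ∷ all-++ʷ w w′ A A′

  reverse : ∀ {x y} → Walk H x y → Walk H y x
  reverse (here x)   = here x
  reverse (step e w) = reverse w ++ʷ step (symm _ _ e) (here _)

  all-reverse : ∀ {P : Fin k → Set} {x y} (w : Walk H x y) →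
                All P (vertices H w) → All P (vertices H (reverse w))
  all-reverse (here _)   A       = A
  all-reverse (step e w) (a ∷ A) =
    all-++ʷ (reverse w) _ (all-reverse w A) (All.lookup A (start∈ w) ∷ a ∷ [])

  walkIn-reverse : ∀ {P x y} → WalkIn P x y → WalkIn P y x
  walkIn-reverse (w , A) = reverse w , all-reverse w A

  infixr 5 _++ᵂ_
  _++ᵂ_ : ∀ {P x y z} → WalkIn P x y → WalkIn P y z → WalkIn P x z
  (w , A) ++ᵂ (w′ , A′) = w ++ʷ w′ , all-++ʷ w w′ A A′

  walkIn-map : ∀ {P Q : Fin k → Set} {x y} → (∀ {v} → P v → Q v) → WalkIn P x y → WalkIn Q x y
  walkIn-map f (w , A) = w , All.map f A

  suffix : ∀ {x y} (w : Walk H x y) {z} → z ∈ₗ vertices H w →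
           Σ (Walk H z y) λ s → vertices H s ⊆ₗ vertices H w × (IsPath H w → IsPath H s)
  suffix (here _)   (here refl) = here _ , id , id
  suffix (step e w) (here refl) = step e w , id , id
  suffix (step e w) (there z∈w) with suffix w z∈w
  ... | s , s⊆w , path = s , there ∘ s⊆w , λ { (_ ∷ w-path) → path w-path }

  toPath : ∀ {x y} (w : Walk H x y) → Σ (Walk H x y) λ p → IsPath H p × vertices H p ⊆ₗ vertices H w
  toPath (here x) = here x , [] ∷ [] , id
  toPath (step {x} e w) with toPath w
  ... | p , p-path , p⊆w with x ∈ₗ? vertices H p
  ...   | yes x∈p = let s , s⊆p , s-path = suffix p x∈p in s , s-path p-path , there ∘ p⊆w ∘ s⊆p
  ...   | no  x∉p = step e p , ¬Any⇒All¬ _ x∉p ∷ p-path , λ { (here eq) → here eq ; (there v∈p) → there (p⊆w v∈p) }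

  pathIn : ∀ {P x y} → WalkIn P x y → Σ (Walk H x y) λ p → IsPath H p × All P (vertices H p)
  pathIn (w , A) with toPath w
  ... | p , p-path , p⊆w = p , p-path , anti-mono p⊆w A

  -- A path visits pairwise distinct vertices, so it has fewer than k edges.
  path-length : ∀ {x y} (p : Walk H x y) → IsPath H p → walkLength H p < k
  path-length p p-path = subst (_≤ k) (vertices-length p)
                           (subst (length (vertices H p) ≤_) (∣⊤∣≡n k)
                             (unique-length p-path (All.tabulate (λ _ → ∈⊤))))
    where
    vertices-length : ∀ {x y} (w : Walk H x y) → length (vertices H w) ≡ suc (walkLength H w)
    vertices-length (here _)   = refl
    vertices-length (step _ w) = cong suc (vertices-length w)

  BoundedWalkIn : (Fin k → Set) → ℕ → Fin k → Fin k → Set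
  BoundedWalkIn P j x y = Σ (Walk H x y) λ w → walkLength H w ≤ j × All P (vertices H w)

  boundedWalkIn? : ∀ {P : Fin k → Set} → Decidable P → ∀ j x y → Dec (BoundedWalkIn P j x y)
  boundedWalkIn? P? zero x y with P? x | x ≟ᶠ y
  ... | yes Px | yes refl = yes (here x , z≤n , Px ∷ [])
  ... | no ¬Px | _        = no λ { (here _ , _ , Px ∷ _) → ¬Px Px ; (step _ _ , () , _) }
  ... | yes _  | no x≢y   = no λ { (here _ , _ , _) → x≢y refl ; (step _ _ , () , _) }
  boundedWalkIn? {P} P? (suc j) x y =
    map′ to from (P? x ×-dec ((x ≟ᶠ y) ⊎-dec any? (λ z → T? (adj x z) ×-dec boundedWalkIn? P? j z y)))
    where
    to : P x × (x ≡ y ⊎ ∃[ z ] (T (adj x z) × BoundedWalkIn P j z y)) → BoundedWalkIn P (suc j) x y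
    to (Px , inj₁ refl)                  = here x , z≤n , Px ∷ []
    to (Px , inj₂ (z , e , w , len , A)) = step e w , s≤s len , Px ∷ A
    from : BoundedWalkIn P (suc j) x y → P x × (x ≡ y ⊎ ∃[ z ] (T (adj x z) × BoundedWalkIn P j z y))
    from (here _ , _ , Px ∷ _)          = Px , inj₁ refl
    from (step e w , s≤s len , Px ∷ A) = Px , inj₂ (_ , e , w , len , A)

  distLe? : ∀ x y j → Dec (DistLe H x y j)
  distLe? x y j = map′ (λ (w , len , _) → w , len)
                       (λ (w , len) → w , len , All.tabulate (λ _ → tt))
                       (boundedWalkIn? {λ _ → Unit} (λ _ → yes tt) j x y)

  -- Connectivity of an induced subgraph is decidable: walks can be taken to be
  -- paths, which have length below k.
  inducesConnected? : ∀ S → Dec (InducesConnected H S)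
  inducesConnected? S =
    map′ to from (all? λ x → all? λ y → (x ∈? S) →-dec (y ∈? S) →-dec boundedWalkIn? (_∈? S) k x y)
    where
    to : (∀ x y → x ∈ S → y ∈ S → BoundedWalkIn (_∈ S) k x y) → InducesConnected H S
    to bounded x y x∈S y∈S = let w , _ , A = bounded x y x∈S y∈S in w , A
    from : InducesConnected H S → ∀ x y → x ∈ S → y ∈ S → BoundedWalkIn (_∈ S) k x y
    from connected x y x∈S y∈S =
      let p , p-path , A = pathIn (connected x y x∈S y∈S)
      in  p , ≤-trans (n≤1+n _) (path-length p p-path) , A

  connected-avoids : ∀ {S x} → InducesConnected H S → x ∉ S → ∀ {a b} → a ∈ S → b ∈ S → WalkIn (_≢ x) a b
  connected-avoids {S} connected x∉S a∈S b∈S =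
    walkIn-map (λ v∈S v≡x → x∉S (subst (_∈ S) v≡x v∈S)) (connected _ _ a∈S b∈S)

  -- Deleting from a connected set a vertex x with at most one neighbour in it
  -- keeps the set connected: a walk entering x must leave it back to the
  -- vertex it came from, so the detour through x can be cut out.
  connected-minus-leaf : ∀ {S x} → InducesConnected H S →
                         (∀ {a b} → a ∈ S → b ∈ S → T (adj x a) → T (adj x b) → a ≡ b) →
                         InducesConnected H (S - x)
  connected-minus-leaf {S} {x} connected one-neighbour a b a∈S-x b∈S-x =
    let w , A = connected a b (⊆S a∈S-x) (⊆S b∈S-x) in avoid (≢x a∈S-x) (≢x b∈S-x) w A
    where
    ⊆S : ∀ {v} → v ∈ S - x → v ∈ S
    ⊆S = p─q⊆p S ⁅ x ⁆
    ≢x : ∀ {v} → v ∈ S - x → v ≢ x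
    ≢x v∈S-x = x∉⁅y⁆⇒x≢y (x∈p─q⇒x∉q S ⁅ x ⁆ v∈S-x)
    avoid : ∀ {a b} → a ≢ x → b ≢ x → (w : Walk H a b) → All (_∈ S) (vertices H w) → WalkIn (_∈ S - x) a b
    avoid a≢x b≢x (here a) (a∈S ∷ []) = here a , x∈p∧x≢y⇒x∈p-y a∈S a≢x ∷ []
    avoid a≢x b≢x (step {v = c} e w) (a∈S ∷ A) with c ≟ᶠ x
    ... | no c≢x = let w′ , A′ = avoid c≢x b≢x w A in step e w′ , x∈p∧x≢y⇒x∈p-y a∈S a≢x ∷ A′
    avoid a≢x b≢x (step e (here _)) _ | yes refl = ⊥-elim (b≢x refl)
    avoid a≢x b≢x (step e (step e′ w)) (a∈S ∷ _ ∷ A) | yes refl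
      with one-neighbour a∈S (All.lookup A (start∈ w)) (symm _ _ e) e′
    ... | refl = avoid a≢x b≢x w A

  degree-one-neighbour : ∀ {S x} → degIn H S x ≡ 1 →
                         ∃[ p ] (p ∈ S × T (adj x p) × ∀ {q} → q ∈ S → T (adj x q) → q ≡ p)
  degree-one-neighbour {S} {x} deg with ∣p∣≡1⇒singleton (S ∩ N H x) deg
  ... | p , p∈S∩N , unique =
    p , proj₁ p∈S×N , ∈N⇒adj (proj₂ p∈S×N) , λ q∈S e → unique (x∈p∩q⁺ (q∈S , adj⇒∈N e))
    where
    p∈S×N : p ∈ S × p ∈ N H x
    p∈S×N = x∈p∩q⁻ S (N H x) p∈S∩N
    ∈N⇒adj : ∀ {q} → q ∈ N H x → T (adj x q)
    ∈N⇒adj = Equivalence.to (∈-tabulate (adj x))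
    adj⇒∈N : ∀ {q} → T (adj x q) → q ∈ N H x
    adj⇒∈N = Equivalence.from (∈-tabulate (adj x))

  -- In a tree, an edge zp separates z from p: no vertex x reaches p avoiding z
  -- and also reaches z avoiding p.  Otherwise the path z, p, …, x and a path
  -- from z to x avoiding p would be two different paths from z to x.
  edge-separates : IsTree H → ∀ {z p x} → T (adj z p) →
                   WalkIn (_≢ z) x p → WalkIn (_≢ p) x z → ⊥
  edge-separates (_ , unique-paths) {z} {p} {x} e x→p x→z
    with pathIn (walkIn-reverse x→p) | pathIn (walkIn-reverse x→z)
  ... | α , α-path , α≢z | β , β-path , β≢p = p∉β (subst (p ∈ₗ_) same-vertices (there (start∈ α)))
    where
    γ : Walk H z x
    γ = step e α
    γ-path : IsPath H γ
    γ-path = All.map (λ v≢z z≡v → v≢z (sym z≡v)) α≢z ∷ α-path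
    same-vertices : vertices H γ ≡ vertices H β
    same-vertices = unique-paths z x γ β γ-path β-path
    p∉β : ¬ (p ∈ₗ vertices H β)
    p∉β p∈β = All.lookup β≢p p∈β refl

module Decomposition {n : ℕ} {G : Graph n} (𝒯 : TreeDecomposition G) where
  open TreeDecomposition 𝒯
  open Walks tree using (WalkIn; _++ᵂ_; walkIn-map)

  -- If a vertex a lies in bags X and Y but not in Z, then X and Y are joined
  -- in the tree avoiding Z (the bags containing a form a subtree).
  bags-joined-avoiding : ∀ Z {a X Y} → a ∉ bag Z → a ∈ bag X → a ∈ bag Y → WalkIn (_≢ Z) X Y
  bags-joined-avoiding Z {a} {X} {Y} a∉Z a∈X a∈Y =
    walkIn-map avoids-Z (coherent a X Y (in-bags a∈X) (in-bags a∈Y))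
    where
    in-bags : ∀ {t} → a ∈ bag t → t ∈ tabulate (λ t → lookup (bag t) a)
    in-bags = Equivalence.from (∈-tabulate _) ∘ Equivalence.to ∈⇔T-lookup
    avoids-Z : ∀ {t} → t ∈ tabulate (λ t → lookup (bag t) a) → t ≢ Z
    avoids-Z t∈ refl = a∉Z (Equivalence.from ∈⇔T-lookup (Equivalence.to (∈-tabulate _) t∈))

  -- Either the walk
  -- meets bag Z (so Z has a vertex within the walk's length of a), or every
  -- step stays inside some bag avoiding Z, joining X to Y in the tree
  -- without passing through Z.
  bag-separation : ∀ Z {X Y a b} → a ∈ bag X → (w : Walk G a b) → b ∈ bag Y →
                   (∃[ c ] (c ∈ bag Z × DistLe G a c (walkLength G w))) ⊎ WalkIn (_≢ Z) X Y
  bag-separation Z {a = a} a∈X w b∈Y with a ∈? bag Z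
  ... | yes a∈Z = inj₁ (a , a∈Z , here a , z≤n)
  bag-separation Z a∈X (here _) b∈Y | no a∉Z = inj₂ (bags-joined-avoiding Z a∉Z a∈X b∈Y)
  bag-separation Z a∈X (step e w) b∈Y | no a∉Z with edgeCovered _ _ e
  ... | W , a∈W , a′∈W with bag-separation Z a′∈W w b∈Y
  ...   | inj₁ (c , c∈Z , w′ , len) = inj₁ (c , c∈Z , step e w′ , s≤s len)
  ...   | inj₂ W→Y = inj₂ (bags-joined-avoiding Z a∉Z a∈X a∈W ++ᵂ W→Y)

module Covering {n : ℕ} {G : Graph n} (𝒯 : TreeDecomposition G) (r : Fin n → ℕ) where
  open TreeDecomposition 𝒯
  open Walks tree using (WalkIn; inducesConnected?)
  open Walks G using (distLe?)
  open Decomposition 𝒯 using (bag-separation)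

  Covers : Fin m → Fin n → Set
  Covers t v = DistSetLe G v (bag t) (r v)

  covers? : ∀ t v → Dec (Covers t v)
  covers? t v = any? λ u → (u ∈? bag t) ×-dec distLe? v u (r v)

  isRCoveringSubtree? : ∀ S → Dec (IsSubtree 𝒯 S × RCovering 𝒯 r S)
  isRCoveringSubtree? S =
    (any? (_∈? S) ×-dec inducesConnected? S) ×-dec (all? λ v → any? λ t → (t ∈? S) ×-dec covers? t v)

  minimum-rCovering : ∀ S → IsSubtree 𝒯 S → RCovering 𝒯 r S → ∃[ S* ] MinRCovering 𝒯 r S*
  minimum-rCovering S S-subtree S-covering
    with minimum-witness isRCoveringSubtree? S (S-subtree , S-covering)
  ... | S* , (S*-subtree , S*-covering) , minimal =
    S* , S*-subtree , S*-covering , λ S′ S′-subtree S′-covering → minimal S′ (S′-subtree , S′-covering)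

  singleton-minimum : ∀ t → (∀ v → Covers t v) → MinRCovering 𝒯 r ⁅ t ⁆
  singleton-minimum t covers-all =
    ((t , x∈⁅x⁆ t) , connected) ,
    (λ v → t , x∈⁅x⁆ t , covers-all v) ,
    λ S′ ((s , s∈S′) , _) _ → subst (_≤ ∣ S′ ∣) (sym (∣⁅x⁆∣≡1 t)) (∈⇒1≤∣p∣ s∈S′)
    where
    connected : InducesConnected tree ⁅ t ⁆
    connected u v u∈ v∈ with x∈⁅y⁆⇒x≡y t u∈ | x∈⁅y⁆⇒x≡y t v∈
    ... | refl | refl = here t , x∈⁅x⁆ t ∷ []

  home : Fin n → Fin m
  home v = proj₁ (vertexCovered v)

  covered-or-separated : ∀ Z {X v} → Covers X v → Covers Z v ⊎ WalkIn (_≢ Z) (home v) X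
  covered-or-separated Z {v = v} (u , u∈X , w , len) with bag-separation Z (proj₂ (vertexCovered v)) w u∈X
  ... | inj₁ (c , c∈Z , w′ , len′) = inj₁ (c , c∈Z , w′ , ≤-trans len′ len)
  ... | inj₂ home→X = inj₂ home→X

module LeafArgument {n : ℕ} {G : Graph n} (𝒯 : TreeDecomposition G) (r : Fin n → ℕ)
  {B : Fin (TreeDecomposition.m 𝒯)} {T_B : Subset (TreeDecomposition.m 𝒯)}
  (T_B-subtree : IsSubtree 𝒯 T_B) (B∈T_B : B ∈ T_B) (T_B-covering : RCovering 𝒯 r T_B)
  (T_B-minimal : ∀ S′ → IsSubtree 𝒯 S′ → B ∈ S′ → RCovering 𝒯 r S′ → ∣ T_B ∣ ≤ ∣ S′ ∣)
  {B′ : Fin (TreeDecomposition.m 𝒯)} (B′-leaf : LeafOf 𝒯 T_B B′) (B′≢B : B′ ≢ B) where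

  open TreeDecomposition 𝒯
  open Graph tree using (adj; irrefl)
  open Walks tree using (WalkIn; walkIn-reverse; _++ᵂ_; connected-avoids; connected-minus-leaf; degree-one-neighbour; edge-separates)
  open Covering 𝒯 r using (Covers; covers?; covered-or-separated)

  neighbour : ∃[ p ] (p ∈ T_B × T (adj B′ p) × ∀ {q} → q ∈ T_B → T (adj B′ q) → q ≡ p)
  neighbour = degree-one-neighbour (proj₂ B′-leaf)

  P : Fin m
  P = proj₁ neighbour

  P∈T_B : P ∈ T_B
  P∈T_B = proj₁ (proj₂ neighbour)

  B′P-edge : T (adj B′ P)
  B′P-edge = proj₁ (proj₂ (proj₂ neighbour))

  only-neighbour : ∀ {q} → q ∈ T_B → T (adj B′ q) → q ≡ P
  only-neighbour = proj₂ (proj₂ (proj₂ neighbour))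

  U : Subset m
  U = T_B - B′

  into-U : ∀ {t} → t ∈ T_B → t ≢ B′ → t ∈ U
  into-U = x∈p∧x≢y⇒x∈p-y

  B′∉U : B′ ∉ U
  B′∉U B′∈U = x∉⁅y⁆⇒x≢y (x∈p─q⇒x∉q T_B ⁅ B′ ⁆ B′∈U) refl

  U-connected : InducesConnected tree U
  U-connected = connected-minus-leaf (proj₂ T_B-subtree)
                  (λ a∈ b∈ e e′ → trans (only-neighbour a∈ e) (sym (only-neighbour b∈ e′)))

  B∈U : B ∈ U
  B∈U = into-U B∈T_B (B′≢B ∘ sym)

  P∈U : P ∈ U
  P∈U = into-U P∈T_B λ P≡B′ → irrefl B′ (subst (T ∘ adj B′) P≡B′ B′P-edge)

  -- U has fewer bags than T_B, so by minimality of T_B it is not r-covering: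
  -- some vertex v is covered by no bag of U.
  uncovered : ∃[ v ] ¬ (∃[ t ] (t ∈ U × Covers t v))
  uncovered = ¬∀⟶∃¬ n _ (λ v → any? λ t → (t ∈? U) ×-dec covers? t v) U-not-covering
    where
    U-not-covering : ¬ RCovering 𝒯 r U
    U-not-covering U-covering =
      <⇒≱ (x∈p⇒∣p-x∣<∣p∣ (proj₁ B′-leaf)) (T_B-minimal U ((B , B∈U) , U-connected) B∈U U-covering)

  v : Fin n
  v = proj₁ uncovered

  v-uncovered : ∀ {t} → t ∈ U → ¬ Covers t v
  v-uncovered t∈U t-covers = proj₂ uncovered (_ , t∈U , t-covers)

  -- Since P cannot cover v, every bag covering v is joined to home v avoiding P.
  avoiding-P : ∀ {X} → Covers X v → WalkIn (_≢ P) (Covering.home 𝒯 r v) X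
  avoiding-P X-covers with covered-or-separated P X-covers
  ... | inj₁ P-covers = ⊥-elim (v-uncovered P∈U P-covers)
  ... | inj₂ home→X   = home→X

  -- T_B covers v, and only by B′.
  B′-covers-v : Covers B′ v
  B′-covers-v with T_B-covering v
  ... | t , t∈T_B , t-covers with t ≟ᶠ B′
  ...   | yes refl = t-covers
  ...   | no t≢B′  = ⊥-elim (v-uncovered (into-U t∈T_B t≢B′) t-covers)

  -- Let X ∈ S cover v; X reaches B′ avoiding P.  If
  -- B′ did not cover w, X would also reach P avoiding B′ (through S, home w
  -- and U), contradicting that the tree edge B′P separates B′ from P.
  B′-covers-all : ∀ {S} → IsSubtree 𝒯 S → RCovering 𝒯 r S → B′ ∉ S → ∀ w → Covers B′ w
  B′-covers-all {S} (_ , S-connected) S-covering B′∉S w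
    with T_B-covering w | S-covering w
  ... | t , t∈T_B , t-covers | Xw , Xw∈S , Xw-covers with t ≟ᶠ B′
  ...   | yes refl = t-covers
  ...   | no t≢B′
    with covered-or-separated B′ Xw-covers | covered-or-separated B′ t-covers
  ...     | inj₁ B′-covers | _              = B′-covers
  ...     | inj₂ _         | inj₁ B′-covers = B′-covers
  ...     | inj₂ home→Xw   | inj₂ home→t    =
    ⊥-elim (edge-separates isTree B′P-edge X→P X→B′)
    where
    X : Fin m
    X = proj₁ (S-covering v)
    X∈S : X ∈ S
    X∈S = proj₁ (proj₂ (S-covering v))
    X→B′ : WalkIn (_≢ P) X B′
    X→B′ = walkIn-reverse (avoiding-P (proj₂ (proj₂ (S-covering v)))) ++ᵂ avoiding-P B′-covers-v
    X→P : WalkIn (_≢ B′) X P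
    X→P = connected-avoids S-connected B′∉S X∈S Xw∈S ++ᵂ walkIn-reverse home→Xw ++ᵂ home→t
          ++ᵂ connected-avoids U-connected B′∉U (into-U t∈T_B t≢B′) P∈U

-- Take a minimum r-covering subtree S.  If it contains B′ we are done;
-- otherwise the single bag B′ covers everything and is itself minimum.
lemma9 : ∀ {n} (G : Graph n) → Connected G → (r : Fin n → ℕ)
    → (𝒯 : TreeDecomposition G) → (B : Fin (TreeDecomposition.m 𝒯))
    → (T_B : Subset (TreeDecomposition.m 𝒯))
    → MinRCoveringContaining 𝒯 r B T_B
    → ∀ B′ → LeafOf 𝒯 T_B B′ → B′ ≢ B
    → ∃[ S ] (MinRCovering 𝒯 r S × B′ ∈ S)
lemma9 G _ r 𝒯 B T_B (T_B-subtree , B∈T_B , T_B-covering , T_B-minimal) B′ B′-leaf B′≢B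
  with Covering.minimum-rCovering 𝒯 r T_B T_B-subtree T_B-covering
... | S , S-minimum@(S-subtree , S-covering , _) with B′ ∈? S
...   | yes B′∈S = S , S-minimum , B′∈S
...   | no  B′∉S = ⁅ B′ ⁆ , Covering.singleton-minimum 𝒯 r B′ B′-covers-all , x∈⁅x⁆ B′
  where
  B′-covers-all : ∀ w → Covering.Covers 𝒯 r B′ w
  B′-covers-all = LeafArgument.B′-covers-all 𝒯 r T_B-subtree B∈T_B T_B-covering T_B-minimal
                    B′-leaf B′≢B S-subtree S-covering B′∉S
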